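{- Let $H$ and $G$ be graphs. If there is a combinatorial embedding of the simple subdivision of $H$ into $G$, then $H$ is a minor of $G$.
   Context: All graphs are finite and simple. $H$ is a minor of $G$ if a graph isomorphic to $H$ can be obtained from $G$ by repeatedly deleting vertices, deleting edges and contracting edges. The simple subdivision of $H=(V,E)$ is the graph with vertex set $V\cup\{(v,u): v,u\in V,\ v\sim u\}$ and edge set $\{\{v,(v,u)\}: v\sim u\}\cup\{\{(v,u),(u,v)\}: u\sim v\}$ (each edge $uv$ is replaced by the path $u,(u,v),(v,u),v$). A combinatorial embedding of a graph $\Gamma=(V,E)$ into a graph $Y$ is a map $f$ assigning to each vertex $v\in V$ a vertex $fv\in V(Y)$ and to each edge $e=uv\in E$ a walk $f_e$ in $Y$ with endpoints $fu$ and $fv$, such that: (1) $f|_V$ is injective; (2) for any two distinct edges $e,t\in E$ sharing no endpoint, the vertex sets of $f_e$ and $f_t$ are disjoint; (3) for every edge $e\in E$ and every vertex $v\notin e$, $fv$ is not a vertex of $f_e$. -}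

module Defs where

open import Data.Nat using (ℕ; zero; suc)
open import Data.Fin using (Fin; punchIn; _≟_)
open import Data.Bool using (Bool; true; false; _∧_; _∨_; not; T)
open import Data.Bool.Properties using (∧-comm; ∨-comm)
open import Data.Sum using (_⊎_; inj₁; inj₂)
open import Data.Product using (Σ; _×_; _,_)
open import Data.List using (List; []; _∷_; reverse)
open import Data.List.Membership.Propositional using (_∈_; _∉_)
open import Relation.Nullary using (¬_)
open import Relation.Nullary.Decidable using (⌊_⌋)
open import Relation.Binary.PropositionalEquality using (_≡_; _≢_; refl; sym; subst; cong₂)
open import Function.Bundles using (_↔_; Inverse)

record Graph : Set where
  field
    n   : ℕ
    adj : Fin n → Fin n → Bool
    adj-sym  : ∀ x y → adj x y ≡ adj y x
    adj-irr  : ∀ x → adj x x ≡ false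

open Graph public

Adj : (G : Graph) → Fin (n G) → Fin (n G) → Set
Adj G x y = T (adj G x y)

Adj-sym : (G : Graph) {x y : Fin (n G)} → Adj G x y → Adj G y x
Adj-sym G {x} {y} h = subst T (adj-sym G x y) h

_==_ : ∀ {m} → Fin m → Fin m → Bool
x == y = ⌊ x ≟ y ⌋

==-sym : ∀ {m} (x y : Fin m) → (x == y) ≡ (y == x)
==-sym x y with x ≟ y | y ≟ x
... | Relation.Nullary.yes _ | Relation.Nullary.yes _ = refl
... | Relation.Nullary.no _  | Relation.Nullary.no _  = refl
... | Relation.Nullary.yes p | Relation.Nullary.no q  = Data.Empty.⊥-elim (q (sym p))
  where import Data.Empty
... | Relation.Nullary.no q  | Relation.Nullary.yes p = Data.Empty.⊥-elim (q (sym p))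
  where import Data.Empty

==-refl : ∀ {m} (x : Fin m) → (x == x) ≡ true
==-refl x with x ≟ x
... | Relation.Nullary.yes _ = refl
... | Relation.Nullary.no q = Data.Empty.⊥-elim (q refl)
  where import Data.Empty

mkGraph : (m : ℕ) → (Fin m → Fin m → Bool) → Graph
mkGraph m r = record
  { n = m
  ; adj = λ x y → not (x == y) ∧ (r x y ∨ r y x)
  ; adj-sym = λ x y → cong₂ (λ a b → not a ∧ b) (==-sym x y) (∨-comm (r x y) (r y x))
  ; adj-irr = λ x → subst (λ b → not b ∧ (r x x ∨ r x x) ≡ false) (sym (==-refl x)) refl
  }

deleteVertex : (G : Graph) → Fin (n G) → Graph
deleteVertex G v = aux (n G) (adj G) v
  where
  aux : (m : ℕ) → (Fin m → Fin m → Bool) → Fin m → Graph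
  aux (suc m) a v = mkGraph m (λ i j → a (punchIn v i) (punchIn v j))

deleteEdge : (G : Graph) → Fin (n G) → Fin (n G) → Graph
deleteEdge G u v = mkGraph (n G)
  (λ x y → adj G x y ∧ not ((x == u ∧ y == v) ∨ (x == v ∧ y == u)))

-- contract the edge uv: v is merged into u (v is removed, u inherits
-- the neighbours of v)
contractEdge : (G : Graph) → Fin (n G) → Fin (n G) → Graph
contractEdge G u v = aux (n G) (adj G) u v
  where
  aux : (m : ℕ) → (Fin m → Fin m → Bool) → Fin m → Fin m → Graph
  aux (suc m) a u v = mkGraph m (λ i j →
    a (punchIn v i) (punchIn v j) ∨ ((punchIn v i == u) ∧ a v (punchIn v j)))

record _≅_ (H G : Graph) : Set where
  field
    bij : Fin (n H) ↔ Fin (n G)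
    preserves : ∀ x y → adj H x y ≡ adj G (Inverse.to bij x) (Inverse.to bij y)

data _IsMinorOf_ (H : Graph) : Graph → Set where
  iso      : ∀ {G} → H ≅ G → H IsMinorOf G
  delVertex : ∀ {G} (v : Fin (n G)) → H IsMinorOf deleteVertex G v → H IsMinorOf G
  delEdge  : ∀ {G} (u v : Fin (n G)) → Adj G u v → H IsMinorOf deleteEdge G u v → H IsMinorOf G
  contract : ∀ {G} (u v : Fin (n G)) → Adj G u v → H IsMinorOf contractEdge G u v → H IsMinorOf G

-- Graphs with an arbitrary vertex type and adjacency relation (used for
-- the simple subdivision, whose vertex set is V ∪ {(v,u) : v ~ u}).

record RelGraph : Set₁ where
  field
    V   : Set
    _~_ : V → V → Set

SubV : Graph → Set
SubV H = Fin (n H) ⊎ Σ (Fin (n H) × Fin (n H)) (λ { (v , u) → Adj H v u })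

data SubAdj (H : Graph) : SubV H → SubV H → Set where
  v-p : ∀ v u (h : Adj H v u) → SubAdj H (inj₁ v) (inj₂ ((v , u) , h))
  p-v : ∀ v u (h : Adj H v u) → SubAdj H (inj₂ ((v , u) , h)) (inj₁ v)
  p-p : ∀ v u (h : Adj H v u) → SubAdj H (inj₂ ((v , u) , h)) (inj₂ ((u , v) , Adj-sym H h))

simpleSubdivision : Graph → RelGraph
simpleSubdivision H = record { V = SubV H ; _~_ = SubAdj H }

data Walk (Y : Graph) : Fin (n Y) → Fin (n Y) → Set where
  [_]  : ∀ x → Walk Y x x
  _∷_ : ∀ {x y z} → Adj Y x y → Walk Y y z → Walk Y x z

verts : ∀ {Y x y} → Walk Y x y → List (Fin (n Y))
verts [ x ] = x ∷ []
verts (_∷_ {x = x} _ w) = x ∷ verts w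

-- Combinatorial embedding of Γ into Y.  A walk is given for each
-- ordered adjacent pair; the walk for (y,x) is the reverse of the walk
-- for (x,y), so this is exactly one walk per edge.
record CombEmbedding (Γ : RelGraph) (Y : Graph) : Set where
  open RelGraph Γ
  field
    f    : V → Fin (n Y)
    fE   : ∀ {x y} → x ~ y → Walk Y (f x) (f y)
    rev  : ∀ {x y} (p : x ~ y) (q : y ~ x) → verts (fE q) ≡ reverse (verts (fE p))
    inj  : ∀ x y → f x ≡ f y → x ≡ y
    disj : ∀ {x y x′ y′} (p : x ~ y) (q : x′ ~ y′) →
           x ≢ x′ → x ≢ y′ → y ≢ x′ → y ≢ y′ →
           ∀ z → z ∈ verts (fE p) → z ∉ verts (fE q)
    avoid : ∀ {x y} (p : x ~ y) z → z ≢ x → z ≢ y → f z ∉ verts (fE p)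

{-# OPTIONS --safe #-}
-- Write c(h) for the image of a vertex h of H and p(h,u) for that of the subdivision vertex (h,u).
-- The branch set of h is its star, namely c(h) together with the walks from c(h) to every p(h,u),
-- plus, for each edge hu with h < u, the part of the walk from p(h,u) to p(u,h) before it first
-- meets the star of u; the edge leaving that part into the star of u realises hu. Conditions (1)-(3)
-- make the stars pairwise disjoint and let the walk of hu meet no star other than those of h and u,
-- and they make the walks of two edges with different smaller endpoints disjoint, so no vertex is
-- claimed by two branch sets. A minor model yields the minor: contract each branch set onto c(h)
-- one edge at a time, delete the vertices outside all branch sets, and finally delete the edges
-- between the c(h) that do not come from H.
module Submission where

open import Defs
open import Data.Bool using (Bool; true; false; _∧_; _∨_; not; T)
open import Data.Bool.Properties using (T-∧; T-∨)
open import Data.Empty using (⊥; ⊥-elim)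
open import Data.Fin using (Fin; punchIn; punchOut; _≟_; _<_; _<?_)
open import Data.Fin.Properties
  using (¬Fin0; any?; all?; ¬∀⟶∃¬; <-cmp; <-asym; punchIn-punchOut; punchOut-punchIn; punchOut-cong; punchInᵢ≢i)
open import Data.List using (List; []; _∷_; allFin; cartesianProduct)
open import Data.List.Membership.Propositional.Properties using (∈-allFin; ∈-cartesianProduct⁺)
open import Data.List.Membership.Propositional using (_∈_)
import Data.List.Membership.DecPropositional as DecMembership
open import Data.List.Relation.Binary.Subset.Propositional using (_⊆_)
open import Data.List.Relation.Unary.Any using (here; there)
open import Data.Nat using (ℕ; zero; suc)
open import Data.Nat.Properties using (suc-injective)
open import Data.Product using (Σ; ∃; ∃₂; _×_; _,_; proj₁; proj₂)
open import Data.Sum using (_⊎_; inj₁; inj₂; [_,_]′)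
open import Data.Unit using (tt)
open import Function using (_∘_; case_of_)
open import Function.Bundles using (_↔_; Inverse; mk↔ₛ′; Equivalence)
open import Relation.Binary.Definitions using (tri<; tri≈; tri>)
open import Relation.Binary.PropositionalEquality
  using (_≡_; _≢_; refl; sym; trans; cong; subst; subst₂)
open import Relation.Nullary using (¬_; Dec; yes; no; contradiction)
open import Relation.Nullary.Decidable
  using (T?; map′; _×-dec_; _⊎-dec_; ¬?; decidable-stable; fromWitness; fromWitnessFalse; toWitness)

adj⇒≢ : ∀ G {x y} → Adj G x y → x ≢ y
adj⇒≢ G {x} xy refl = subst T (adj-irr G x) xy

T-not⇒¬T : ∀ {b} → T (not b) → ¬ T b
T-not⇒¬T {false} _ ()

¬T⇒T-not : ∀ {b} → ¬ T b → T (not b)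
¬T⇒T-not {false} _  = tt
¬T⇒T-not {true}  ¬t = ¬t tt

T-⇔⇒≡ : ∀ {a b} → (T a → T b) → (T b → T a) → a ≡ b
T-⇔⇒≡ {false} {false} _ _ = refl
T-⇔⇒≡ {false} {true}  _ f = ⊥-elim (f tt)
T-⇔⇒≡ {true}  {false} t _ = ⊥-elim (t tt)
T-⇔⇒≡ {true}  {true}  _ _ = refl

T-Σ? : ∀ {b} {Q : T b → Set} → (∀ t → Dec (Q t)) → Dec (Σ (T b) Q)
T-Σ? {false} _  = no proj₁
T-Σ? {true}  Q? = map′ (tt ,_) proj₂ (Q? tt)

module _ {m : ℕ} (r : Fin m → Fin m → Bool) where

  mkGraph-adj : ∀ {x y} → x ≢ y → T (r x y) → Adj (mkGraph m r) x y
  mkGraph-adj {x} {y} x≢y rxy =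
    Equivalence.from (T-∧ {not (x == y)}) (fromWitnessFalse x≢y , Equivalence.from (T-∨ {r x y}) (inj₁ rxy))

  mkGraph-adj⁻ : ∀ {x y} → Adj (mkGraph m r) x y → T (r x y) ⊎ T (r y x)
  mkGraph-adj⁻ {x} {y} xy = Equivalence.to (T-∨ {r x y}) (proj₂ (Equivalence.to (T-∧ {not (x == y)}) xy))

module _ (G : Graph) (u v : Fin (n G)) where

  private
    IsUV : Fin (n G) → Fin (n G) → Bool
    IsUV x y = (x == u ∧ y == v) ∨ (x == v ∧ y == u)

    kept : Fin (n G) → Fin (n G) → Bool
    kept x y = adj G x y ∧ not (IsUV x y)

    isUV : ∀ {x y} → (x ≡ u × y ≡ v) ⊎ (x ≡ v × y ≡ u) → T (IsUV x y)
    isUV {x} {y} (inj₁ (refl , refl)) =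
      Equivalence.from (T-∨ {x == u ∧ y == v}) (inj₁ (Equivalence.from (T-∧ {x == u}) (fromWitness refl , fromWitness refl)))
    isUV {x} {y} (inj₂ (refl , refl)) =
      Equivalence.from (T-∨ {x == u ∧ y == v}) (inj₂ (Equivalence.from (T-∧ {x == v}) (fromWitness refl , fromWitness refl)))

    isUV⁻ : ∀ {x y} → T (IsUV x y) → (x ≡ u × y ≡ v) ⊎ (x ≡ v × y ≡ u)
    isUV⁻ {x} {y} t with Equivalence.to (T-∨ {x == u ∧ y == v}) t
    ... | inj₁ t₁ = let (p , q) = Equivalence.to (T-∧ {x == u}) t₁ in inj₁ (toWitness p , toWitness q)
    ... | inj₂ t₂ = let (p , q) = Equivalence.to (T-∧ {x == v}) t₂ in inj₂ (toWitness p , toWitness q)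

  deleteEdge-adj : ∀ {x y} → Adj G x y → ¬ (x ≡ u × y ≡ v) → ¬ (x ≡ v × y ≡ u) → Adj (deleteEdge G u v) x y
  deleteEdge-adj {x} {y} xy ¬uv ¬vu = mkGraph-adj kept (adj⇒≢ G xy)
    (Equivalence.from (T-∧ {adj G x y}) (xy , ¬T⇒T-not λ t → [ ¬uv , ¬vu ]′ (isUV⁻ t)))

  deleteEdge-adj⁻ : ∀ {x y} → Adj (deleteEdge G u v) x y → Adj G x y
  deleteEdge-adj⁻ {x} {y} xy with mkGraph-adj⁻ kept xy
  ... | inj₁ rxy = proj₁ (Equivalence.to (T-∧ {adj G x y}) rxy)
  ... | inj₂ ryx = Adj-sym G (proj₁ (Equivalence.to (T-∧ {adj G y x}) ryx))

  deleteEdge-¬adj : ¬ Adj (deleteEdge G u v) u v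
  deleteEdge-¬adj uv with mkGraph-adj⁻ kept uv
  ... | inj₁ ruv = T-not⇒¬T (proj₂ (Equivalence.to (T-∧ {adj G u v}) ruv)) (isUV (inj₁ (refl , refl)))
  ... | inj₂ rvu = T-not⇒¬T (proj₂ (Equivalence.to (T-∧ {adj G v u}) rvu)) (isUV (inj₂ (refl , refl)))

data WalkIn (G : Graph) (S : Fin (n G) → Set) : Fin (n G) → Fin (n G) → Set where
  done : ∀ {x} → S x → WalkIn G S x x
  step : ∀ {x y z} → S x → Adj G x y → WalkIn G S y z → WalkIn G S x z

module _ {G : Graph} {S : Fin (n G) → Set} where

  WalkIn-head : ∀ {x y} → WalkIn G S x y → S x
  WalkIn-head (done s)     = s
  WalkIn-head (step s _ _) = s

  WalkIn-map : ∀ {S′ : Fin (n G) → Set} → (∀ {z} → S z → S′ z) → ∀ {x y} → WalkIn G S x y → WalkIn G S′ x y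
  WalkIn-map g (done s)     = done (g s)
  WalkIn-map g (step s e w) = step (g s) e (WalkIn-map g w)

  _++ᵂ_ : ∀ {x y z} → WalkIn G S x y → WalkIn G S y z → WalkIn G S x z
  done _     ++ᵂ w′ = w′
  step s e w ++ᵂ w′ = step s e (w ++ᵂ w′)

  WalkIn-leave : ∀ {x y} → WalkIn G S x y → x ≢ y → ∃ λ z → S z × Adj G x z
  WalkIn-leave (done _)     x≢x = contradiction refl x≢x
  WalkIn-leave (step _ e w) _   = _ , WalkIn-head w , e

module _ {G : Graph} where

  start∈verts : ∀ {a b} (w : Walk G a b) → a ∈ verts w
  start∈verts [ _ ]   = here refl
  start∈verts (_ ∷ _) = here refl

  end∈verts : ∀ {a b} (w : Walk G a b) → b ∈ verts w
  end∈verts [ _ ]   = here refl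
  end∈verts (_ ∷ w) = there (end∈verts w)

  walkIn-to-start : ∀ {a b z} (w : Walk G a b) → z ∈ verts w → WalkIn G (_∈ verts w) z a
  walkIn-to-start [ _ ]   (here refl) = done (here refl)
  walkIn-to-start (_ ∷ _) (here refl) = done (here refl)
  walkIn-to-start (e ∷ w) (there z∈w) =
    WalkIn-map there (walkIn-to-start w z∈w) ++ᵂ step (there (start∈verts w)) (Adj-sym G e) (done (here refl))

  record FirstEntry (P : Fin (n G) → Set) {a b} (w : Walk G a b) : Set where
    field
      {exit entry}  : Fin (n G)
      prefix        : Walk G a exit
      crossing      : Adj G exit entry
      entered       : P entry
      prefix⊆       : verts prefix ⊆ verts w
      prefix-avoids : ∀ {z} → z ∈ verts prefix → ¬ P z

  firstEntry : ∀ {P : Fin (n G) → Set} → (∀ z → Dec (P z)) →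
               ∀ {a b} (w : Walk G a b) → ¬ P a → P b → FirstEntry P w
  firstEntry P? [ _ ] ¬Pa Pb = contradiction Pb ¬Pa
  firstEntry P? (_∷_ {y = a′} e w) ¬Pa Pb with P? a′
  ... | yes Pa′ = record
    { prefix = [ _ ] ; crossing = e ; entered = Pa′
    ; prefix⊆ = λ { (here refl) → here refl }
    ; prefix-avoids = λ { (here refl) → ¬Pa } }
  ... | no ¬Pa′ = record
    { prefix = e ∷ prefix ; crossing = crossing ; entered = entered
    ; prefix⊆ = λ { (here refl) → here refl ; (there z∈p) → there (prefix⊆ z∈p) }
    ; prefix-avoids = λ { (here refl) → ¬Pa ; (there z∈p) → prefix-avoids z∈p } }
    where open FirstEntry (firstEntry P? w ¬Pa′ Pb)

module _ {H : Graph} where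

  private
    removeExtraEdges : ∀ {G} (e : Fin (n H) ↔ Fin (n G)) → let open Inverse e in
      (∀ {a b} → Adj H a b → Adj G (to a) (to b)) →
      (L : List (Fin (n G) × Fin (n G))) →
      (∀ {x y} → Adj G x y → ¬ Adj H (from x) (from y) → (x , y) ∈ L) →
      H IsMinorOf G
    removeExtraEdges {G} e preserves-adj [] extra∈L = iso (record { bij = e ; preserves = preserves })
      where
      open Inverse e
      preserves : ∀ a b → adj H a b ≡ adj G (to a) (to b)
      preserves a b = T-⇔⇒≡ preserves-adj λ ab → subst₂ (Adj H) (strictlyInverseʳ a) (strictlyInverseʳ b)
        (decidable-stable (T? _) λ ¬ab → case extra∈L ab ¬ab of λ ())
    removeExtraEdges {G} e preserves-adj ((u , v) ∷ L) extra∈L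
      with T? (adj G u v) ×-dec ¬? (T? (adj H (Inverse.from e u) (Inverse.from e v)))
    ... | yes (uv , ¬h) = delEdge u v uv (removeExtraEdges e preserves-adj′ L extra∈L′)
      where
      open Inverse e
      adj-from : ∀ {a b x y} → Adj H a b → to a ≡ x → to b ≡ y → Adj H (from x) (from y)
      adj-from {a} {b} ab refl refl = subst₂ (Adj H) (sym (strictlyInverseʳ a)) (sym (strictlyInverseʳ b)) ab
      preserves-adj′ : ∀ {a b} → Adj H a b → Adj (deleteEdge G u v) (to a) (to b)
      preserves-adj′ ab = deleteEdge-adj G u v (preserves-adj ab)
        (λ (p , q) → ¬h (adj-from ab p q)) (λ (p , q) → ¬h (adj-from (Adj-sym H ab) q p))
      extra∈L′ : ∀ {x y} → Adj (deleteEdge G u v) x y → ¬ Adj H (from x) (from y) → (x , y) ∈ L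
      extra∈L′ xy ¬h′ with extra∈L (deleteEdge-adj⁻ G u v xy) ¬h′
      ... | here refl = contradiction xy (deleteEdge-¬adj G u v)
      ... | there p   = p
    ... | no ¬extra = removeExtraEdges e preserves-adj L extra∈L′
      where
      extra∈L′ : ∀ {x y} → Adj G x y → ¬ Adj H (Inverse.from e x) (Inverse.from e y) → (x , y) ∈ L
      extra∈L′ xy ¬h′ with extra∈L xy ¬h′
      ... | here refl = contradiction (xy , ¬h′) ¬extra
      ... | there p   = p

  spanning⇒minor : ∀ {G} (e : Fin (n H) ↔ Fin (n G)) →
                   (∀ {a b} → Adj H a b → Adj G (Inverse.to e a) (Inverse.to e b)) → H IsMinorOf G
  spanning⇒minor {G} e preserves-adj = removeExtraEdges e preserves-adj (cartesianProduct (allFin (n G)) (allFin (n G)))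
    λ {x} {y} _ _ → ∈-cartesianProduct⁺ (∈-allFin x) (∈-allFin y)

record MinorModel (H G : Graph) : Set₁ where
  field
    Branch        : Fin (n H) → Fin (n G) → Set
    branch?       : ∀ h z → Dec (Branch h z)
    branch-unique : ∀ {h k z} → Branch h z → Branch k z → h ≡ k
    root          : Fin (n H) → Fin (n G)
    root-branch   : ∀ h → Branch h (root h)
    connected     : ∀ {h z} → Branch h z → WalkIn G (Branch h) z (root h)
    adjacent      : ∀ {h k} → Adj H h k → ∃₂ λ z z′ → Branch h z × Branch k z′ × Adj G z z′

module _ {H G : Graph} (M : MinorModel H G) where
  open MinorModel M

  -- G′ arises from G by deleting or identifying vertices: embed includes the surviving vertices
  -- into G, and collapse sends a branch vertex to the survivor it is identified with.
  record Collapse (G′ : Graph) : Set where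
    field
      embed               : Fin (n G′) → Fin (n G)
      collapse            : ∀ {h z} → Branch h z → Fin (n G′)
      collapse-irrelevant : ∀ {h k z} (b : Branch h z) (b′ : Branch k z) → collapse b ≡ collapse b′
      collapse-embed      : ∀ {h i} (b : Branch h (embed i)) → collapse b ≡ i
      collapse-branch     : ∀ {h z} (b : Branch h z) → Branch h (embed (collapse b))
      collapse-adj        : ∀ {h k z z′} (b : Branch h z) (b′ : Branch k z′) →
                            Adj G z z′ → collapse b ≢ collapse b′ → Adj G′ (collapse b) (collapse b′)

  pullModel : ∀ {G′} → Collapse G′ → MinorModel H G′
  pullModel {G′} C = record
    { Branch        = λ h i → Branch h (embed i)
    ; branch?       = λ h i → branch? h (embed i)
    ; branch-unique = branch-unique
    ; root          = λ h → collapse (root-branch h)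
    ; root-branch   = λ h → collapse-branch (root-branch h)
    ; connected     = λ {h} b → subst (λ i → WalkIn G′ (λ j → Branch h (embed j)) i (collapse (root-branch h)))
                                      (collapse-embed (WalkIn-head (connected b)))
                                      (pullWalk (connected b) (root-branch h))
    ; adjacent      = adjacent′
    }
    where
    open Collapse C

    pullWalk : ∀ {h x y} (w : WalkIn G (Branch h) x y) (b : Branch h y) →
               WalkIn G′ (λ i → Branch h (embed i)) (collapse (WalkIn-head w)) (collapse b)
    pullWalk (done bx) b = subst (λ i → WalkIn G′ _ (collapse bx) i) (collapse-irrelevant bx b) (done (collapse-branch bx))
    pullWalk (step bx e w) b with collapse bx ≟ collapse (WalkIn-head w)
    ... | yes same = subst (λ i → WalkIn G′ _ i (collapse b)) (sym same) (pullWalk w b)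
    ... | no moved = step (collapse-branch bx) (collapse-adj bx (WalkIn-head w) e moved) (pullWalk w b)

    adjacent′ : ∀ {h k} → Adj H h k → ∃₂ λ i i′ → Branch h (embed i) × Branch k (embed i′) × Adj G′ i i′
    adjacent′ {h} {k} hk with adjacent hk
    ... | z , z′ , b , b′ , zz′ = collapse b , collapse b′ , collapse-branch b , collapse-branch b′ ,
          collapse-adj b b′ zz′ λ same → adj⇒≢ H hk
            (branch-unique (collapse-branch b) (subst (λ i → Branch k (embed i)) (sym same) (collapse-branch b′)))

deleteVertex-size : ∀ G v → suc (n (deleteVertex G v)) ≡ n G
deleteVertex-size record { n = suc _ } _ = refl

contractEdge-size : ∀ G u v → suc (n (contractEdge G u v)) ≡ n G
contractEdge-size record { n = suc _ } _ _ = refl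

module _ {H : Graph} where
  open MinorModel

  deleteModel : ∀ {G} (M : MinorModel H G) v → (∀ h → ¬ Branch M h v) → MinorModel H (deleteVertex G v)
  deleteModel {G@record { n = suc m }} M v free = pullModel M (record
    { embed               = punchIn v
    ; collapse            = λ b → punchOut (v≢ b)
    ; collapse-irrelevant = λ _ _ → punchOut-cong v refl
    ; collapse-embed      = λ _ → trans (punchOut-cong v refl) (punchOut-punchIn v)
    ; collapse-branch     = λ b → subst (Branch M _) (sym (punchIn-punchOut (v≢ b))) b
    ; collapse-adj        = λ b b′ zz′ moved → mkGraph-adj remaining moved
        (subst₂ (Adj G) (sym (punchIn-punchOut (v≢ b))) (sym (punchIn-punchOut (v≢ b′))) zz′)
    })
    where
    v≢ : ∀ {h z} → Branch M h z → v ≢ z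
    v≢ {h} b refl = free h b

    remaining : Fin m → Fin m → Bool
    remaining i j = adj G (punchIn v i) (punchIn v j)

  contractModel : ∀ {G} (M : MinorModel H G) {h x y} → Branch M h x → Branch M h y → Adj G y x →
                  MinorModel H (contractEdge G y x)
  contractModel {G@record { n = suc m }} M {x = x} {y} bx by yx = pullModel M (record
    { embed               = punchIn x
    ; collapse            = λ {_} {z} _ → merge z
    ; collapse-irrelevant = λ _ _ → refl
    ; collapse-embed      = λ {_} {i} _ → merge-punchIn i
    ; collapse-branch     = collapse-branch
    ; collapse-adj        = λ {_} {_} {z} {z′} _ _ zz′ moved → merge-adj z z′ zz′ moved
    })
    where
    x≢y : x ≢ y
    x≢y = adj⇒≢ G (Adj-sym G yx)

    merge : Fin (suc m) → Fin m
    merge z with z ≟ x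
    ... | yes _   = punchOut x≢y
    ... | no z≢x = punchOut (z≢x ∘ sym)

    punchIn-merge : ∀ z → punchIn x (merge z) ≡ z ⊎ (z ≡ x × punchIn x (merge z) ≡ y)
    punchIn-merge z with z ≟ x
    ... | yes refl = inj₂ (refl , punchIn-punchOut x≢y)
    ... | no z≢x  = inj₁ (punchIn-punchOut (z≢x ∘ sym))

    merge-punchIn : ∀ i → merge (punchIn x i) ≡ i
    merge-punchIn i with punchIn x i ≟ x
    ... | yes eq = contradiction eq (punchInᵢ≢i x i)
    ... | no _   = trans (punchOut-cong x refl) (punchOut-punchIn x)

    collapse-branch : ∀ {h z} → Branch M h z → Branch M h (punchIn x (merge z))
    collapse-branch {h} {z} b with punchIn-merge z
    ... | inj₁ eq          = subst (Branch M h) (sym eq) b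
    ... | inj₂ (refl , eq) = subst (Branch M h) (sym eq) (subst (λ k → Branch M k y) (branch-unique M bx b) by)

    merged : Fin m → Fin m → Bool
    merged i j = adj G (punchIn x i) (punchIn x j) ∨ ((punchIn x i == y) ∧ adj G x (punchIn x j))

    merge-adj : ∀ z z′ → Adj G z z′ → merge z ≢ merge z′ → Adj (contractEdge G y x) (merge z) (merge z′)
    merge-adj z z′ zz′ moved with punchIn-merge z | punchIn-merge z′
    ... | inj₁ eq | inj₁ eq′ = mkGraph-adj merged moved
      (Equivalence.from (T-∨ {adj G _ _}) (inj₁ (subst₂ (Adj G) (sym eq) (sym eq′) zz′)))
    ... | inj₂ (refl , eq) | inj₁ eq′ = mkGraph-adj merged moved   -- x's edges are inherited by y
      (Equivalence.from (T-∨ {adj G _ _}) (inj₂ (Equivalence.from (T-∧ {_ == y})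
        (fromWitness eq , subst (Adj G x) (sym eq′) zz′))))
    ... | inj₁ eq | inj₂ (refl , eq′) = Adj-sym (contractEdge G y x) (mkGraph-adj merged (moved ∘ sym)
      (Equivalence.from (T-∨ {adj G _ _}) (inj₂ (Equivalence.from (T-∧ {_ == y})
        (fromWitness eq′ , subst (Adj G x) (sym eq) (Adj-sym G zz′))))))
    ... | inj₂ (refl , _) | inj₂ (refl , _) = contradiction refl (adj⇒≢ G zz′)

  IsRoot : ∀ {G} → MinorModel H G → Fin (n G) → Set
  IsRoot M z = ∃ λ h → Branch M h z × root M h ≡ z

  isRoot? : ∀ {G} (M : MinorModel H G) z → Dec (IsRoot M z)
  isRoot? M z = any? λ h → branch? M h z ×-dec root M h ≟ z

  allRoots⇒minor : ∀ {G} (M : MinorModel H G) → (∀ z → IsRoot M z) → H IsMinorOf G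
  allRoots⇒minor {G} M roots = spanning⇒minor (mk↔ₛ′ (root M) owner root-owner owner-root) root-adj
    where
    owner : Fin (n G) → Fin (n H)
    owner z = proj₁ (roots z)
    root-owner : ∀ z → root M (owner z) ≡ z
    root-owner z = proj₂ (proj₂ (roots z))
    owner-root : ∀ h → owner (root M h) ≡ h
    owner-root h = branch-unique M (proj₁ (proj₂ (roots (root M h)))) (root-branch M h)
    branch⇒root : ∀ {h z} → Branch M h z → root M h ≡ z
    branch⇒root {z = z} b = trans (cong (root M) (branch-unique M b (proj₁ (proj₂ (roots z))))) (root-owner z)
    root-adj : ∀ {h k} → Adj H h k → Adj G (root M h) (root M k)
    root-adj hk with adjacent M hk
    ... | _ , _ , b , b′ , zz′ = subst₂ (Adj G) (sym (branch⇒root b)) (sym (branch⇒root b′)) zz′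

  record SmallerModel (G : Graph) : Set₁ where
    field
      {graph} : Graph
      fewer   : suc (n graph) ≡ n G
      model   : MinorModel H graph
      lift    : H IsMinorOf graph → H IsMinorOf G

  shrinkModel : ∀ {G} (M : MinorModel H G) → ∃ (¬_ ∘ IsRoot M) → SmallerModel G
  shrinkModel {G} M (z , ¬root) with any? (λ h → branch? M h z)
  ... | no free = record
    { fewer = deleteVertex-size G z ; model = deleteModel M z (λ h b → free (h , b)) ; lift = delVertex z }
  ... | yes (h , b) with WalkIn-leave (connected M b) (λ z≡root → ¬root (h , b , sym z≡root))
  ...   | y , by , zy = record
    { fewer = contractEdge-size G y z ; model = contractModel M b by (Adj-sym G zy) ; lift = contract y z (Adj-sym G zy) }

  model⇒minor : ∀ {G} → MinorModel H G → H IsMinorOf G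
  model⇒minor = reduce _ refl
    where
    reduce : ∀ k {G} → n G ≡ k → MinorModel H G → H IsMinorOf G
    reduce zero    empty M = allRoots⇒minor M λ z → ⊥-elim (¬Fin0 (subst Fin empty z))
    reduce (suc k) size  M with all? (isRoot? M)
    ... | yes roots = allRoots⇒minor M roots
    ... | no ¬roots = lift (reduce k (suc-injective (trans fewer size)) model)
      where open SmallerModel (shrinkModel M (¬∀⟶∃¬ _ _ (isRoot? M) ¬roots))

module _ {H G : Graph} (E : CombEmbedding (simpleSubdivision H) G) where
  open CombEmbedding E
  open DecMembership (_≟_ {n G}) using (_∈?_)

  private
    near far : SubV H → Fin (n H)
    near (inj₁ h)             = h
    near (inj₂ ((h , _) , _)) = h
    far  (inj₁ h)             = h
    far  (inj₂ ((_ , u) , _)) = u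

  centre : Fin (n H) → Fin (n G)
  centre h = f (inj₁ h)

  port : ∀ {h u} → Adj H h u → Fin (n G)
  port {h} {u} hu = f (inj₂ ((h , u) , hu))

  spoke : ∀ {h u} (hu : Adj H h u) → Walk G (centre h) (port hu)
  spoke {h} {u} hu = fE (v-p h u hu)

  bridge : ∀ {h u} (hu : Adj H h u) → Walk G (port hu) (port (Adj-sym H hu))
  bridge {h} {u} hu = fE (p-p h u hu)

  Star : Fin (n H) → Fin (n G) → Set
  Star h z = z ≡ centre h ⊎ ∃ λ u → Σ (Adj H h u) λ hu → z ∈ verts (spoke hu)

  star? : ∀ h z → Dec (Star h z)
  star? h z = z ≟ centre h ⊎-dec any? λ u → T-Σ? λ hu → z ∈? verts (spoke hu)

  port∈star : ∀ {h u} (hu : Adj H h u) → Star h (port hu)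
  port∈star hu = inj₂ (_ , hu , end∈verts (spoke hu))

  stars-disjoint : ∀ {h k z} → h ≢ k → Star h z → Star k z → ⊥
  stars-disjoint h≢k (inj₁ refl) (inj₁ eq) = h≢k (cong near (inj _ _ eq))
  stars-disjoint h≢k (inj₁ refl) (inj₂ (_ , ku , z∈k)) =
    avoid (v-p _ _ ku) _ (h≢k ∘ cong near) (λ ()) z∈k
  stars-disjoint h≢k (inj₂ (_ , hu , z∈h)) (inj₁ refl) =
    avoid (v-p _ _ hu) _ (h≢k ∘ sym ∘ cong near) (λ ()) z∈h
  stars-disjoint h≢k (inj₂ (_ , hu , z∈h)) (inj₂ (_ , ku , z∈k)) =
    disj (v-p _ _ hu) (v-p _ _ ku) (h≢k ∘ cong near) (λ ()) (λ ()) (h≢k ∘ cong near) _ z∈h z∈k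

  star-unique : ∀ {h k z} → Star h z → Star k z → h ≡ k
  star-unique {h} {k} s s′ = decidable-stable (h ≟ k) λ h≢k → stars-disjoint h≢k s s′

  bridge-avoids-stars : ∀ {h u k z} (hu : Adj H h u) → k ≢ h → k ≢ u → z ∈ verts (bridge hu) → ¬ Star k z
  bridge-avoids-stars hu k≢h k≢u z∈b (inj₁ refl) = avoid (p-p _ _ hu) _ (λ ()) (λ ()) z∈b
  bridge-avoids-stars hu k≢h k≢u z∈b (inj₂ (_ , kv , z∈s)) =
    disj (p-p _ _ hu) (v-p _ _ kv) (λ ()) (k≢h ∘ sym ∘ cong near) (λ ()) (k≢u ∘ sym ∘ cong near) _ z∈b z∈s

  bridges-disjoint : ∀ {h u k v z} (hu : Adj H h u) (kv : Adj H k v) → h ≢ k → h < u → k < v →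
                     z ∈ verts (bridge hu) → z ∈ verts (bridge kv) → ⊥
  bridges-disjoint hu kv h≢k h<u k<v =
    disj (p-p _ _ hu) (p-p _ _ kv) (h≢k ∘ cong near)
      (λ eq → <-asym h<u (subst₂ _<_ (sym (cong far eq)) (sym (cong near eq)) k<v))
      (λ eq → <-asym h<u (subst₂ _<_ (sym (cong near eq)) (sym (cong far eq)) k<v))
      (h≢k ∘ cong far) _

  bridgeEntry : ∀ {h u} (hu : Adj H h u) → FirstEntry (Star u) (bridge hu)
  bridgeEntry hu = firstEntry (star? _) (bridge hu)
    (λ s → adj⇒≢ H hu (star-unique (port∈star hu) s)) (port∈star (Adj-sym H hu))

  open FirstEntry

  Claimed : Fin (n H) → Fin (n G) → Set
  Claimed h z = ∃ λ u → Σ (Adj H h u) λ hu → h < u × z ∈ verts (prefix (bridgeEntry hu))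

  claimed? : ∀ h z → Dec (Claimed h z)
  claimed? h z = any? λ u → T-Σ? λ hu → h <? u ×-dec z ∈? verts (prefix (bridgeEntry hu))

  star-claimed-unique : ∀ {h k z} → Star h z → Claimed k z → h ≡ k
  star-claimed-unique {h} {k} s (u , ku , _ , z∈p) = decidable-stable (h ≟ k) λ h≢k →
    bridge-avoids-stars ku h≢k (λ { refl → prefix-avoids (bridgeEntry ku) z∈p s })
      (prefix⊆ (bridgeEntry ku) z∈p) s

  claimed-unique : ∀ {h k z} → Claimed h z → Claimed k z → h ≡ k
  claimed-unique {h} {k} (_ , hu , h<u , z∈p) (_ , kv , k<v , z∈q) = decidable-stable (h ≟ k) λ h≢k →
    bridges-disjoint hu kv h≢k h<u k<v (prefix⊆ (bridgeEntry hu) z∈p) (prefix⊆ (bridgeEntry kv) z∈q)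

  Branch : Fin (n H) → Fin (n G) → Set
  Branch h z = Star h z ⊎ Claimed h z

  branch-unique : ∀ {h k z} → Branch h z → Branch k z → h ≡ k
  branch-unique (inj₁ s) (inj₁ s′) = star-unique s s′
  branch-unique (inj₁ s) (inj₂ c′) = star-claimed-unique s c′
  branch-unique (inj₂ c) (inj₁ s′) = sym (star-claimed-unique s′ c)
  branch-unique (inj₂ c) (inj₂ c′) = claimed-unique c c′

  star-connected : ∀ {h z} → Star h z → WalkIn G (Star h) z (centre h)
  star-connected (inj₁ refl)          = done (inj₁ refl)
  star-connected (inj₂ (_ , hu , z∈s)) = WalkIn-map (λ y∈s → inj₂ (_ , hu , y∈s)) (walkIn-to-start (spoke hu) z∈s)

  branch-connected : ∀ {h z} → Branch h z → WalkIn G (Branch h) z (centre h)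
  branch-connected (inj₁ s) = WalkIn-map inj₁ (star-connected s)
  branch-connected (inj₂ (_ , hu , h<u , z∈p)) =
    WalkIn-map (λ y∈p → inj₂ (_ , hu , h<u , y∈p)) (walkIn-to-start (prefix (bridgeEntry hu)) z∈p)
    ++ᵂ WalkIn-map inj₁ (star-connected (port∈star hu))

  branch-adjacent : ∀ {h k} → Adj H h k → ∃₂ λ z z′ → Branch h z × Branch k z′ × Adj G z z′
  branch-adjacent {h} {k} hk with <-cmp h k
  ... | tri< h<k _ _ = let B = bridgeEntry hk in
    exit B , entry B , inj₂ (k , hk , h<k , end∈verts (prefix B)) , inj₁ (entered B) , crossing B
  ... | tri≈ _ h≡k _ = contradiction h≡k (adj⇒≢ H hk)
  ... | tri> _ _ k<h = let B = bridgeEntry (Adj-sym H hk) in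
    entry B , exit B , inj₁ (entered B) , inj₂ (h , Adj-sym H hk , k<h , end∈verts (prefix B)) , Adj-sym G (crossing B)

  embedding⇒model : MinorModel H G
  embedding⇒model = record
    { Branch        = Branch
    ; branch?       = λ h z → star? h z ⊎-dec claimed? h z
    ; branch-unique = branch-unique
    ; root          = centre
    ; root-branch   = λ h → inj₁ (inj₁ refl)
    ; connected     = branch-connected
    ; adjacent      = branch-adjacent
    }

mainTheorem7 : (H G : Graph) → CombEmbedding (simpleSubdivision H) G → H IsMinorOf G
mainTheorem7 H G E = model⇒minor (embedding⇒model E)
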